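{- Let $K_n$ denote the complete (undirected) graph on $n$ vertices. Then the convergence time of the asynchronous maximum model on $K_n$ satisfies $\mathcal{T}(K_n)=\Theta(n\log n)$; that is, there are constants $c,C>0$ such that $c\,n\log n\le \mathcal{T}(K_n)\le C\,n\log n$ for all sufficiently large $n$.
   Context: Let $G=(V,E)$ be a finite simple graph with $n=|V|$ vertices and write $[n]=\{1,\dots,n\}$. A valuation is a function $f:V\to[n]$. The asynchronous maximum model is the following discrete-time random process on valuations: given the current valuation $f_t$, choose a vertex $v'\in V$ uniformly at random, independently of the past; set $f_{t+1}(v')=\max\{f_t(u): u\neq v',\ u \text{ adjacent to } v'\}$ if $v'$ has at least one neighbour, and $f_{t+1}(v')=f_t(v')$ otherwise; and $f_{t+1}(v)=f_t(v)$ for $v\neq v'$. (The chosen vertex's own value is not included in the maximum.) Each step is a round. The Markov chain of possibilities is the directed graph (loops allowed) whose vertices are all valuations, with an edge $f\to g$ whenever the one-round transition probability from $f$ to $g$ is positive; its absorbing components are the maximal strongly connected components with no edge leaving them. For a valuation $f$, let $Y_f$ be the number of rounds until the process started at $f_0=f$ first reaches a valuation in an absorbing component, $T(G,f)=\mathbb{E}[Y_f]$, and $\mathcal{T}(G)=\max_f T(G,f)$ over all valuations $f:V\to[n]$. $\log$ is the natural logarithm. -}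

module Defs where

open import Data.Bool using (Bool; true; false; if_then_else_; not; _∧_; _∨_)
open import Data.Nat as ℕ using (ℕ; zero; suc; _^_; _≤ᵇ_)
open import Data.Fin using (Fin; toℕ)
open import Data.Fin.Properties using (_≟_)
open import Data.List using (List; []; _∷_; foldr; map; concatMap)
open import Data.Bool.ListAction using (all; any)
open import Data.Vec using (Vec; []; _∷_; lookup; _[_]≔_; toList)
open import Data.Maybe using (Maybe; just; nothing)
open import Data.Integer using (+_)
open import Data.Rational using (ℚ; 0ℚ; 1ℚ; _+_; _*_; _/_)
open import Relation.Nullary.Decidable using (⌊_⌋)

Adj : ℕ → Set
Adj n = Fin n → Fin n → Bool

K : (n : ℕ) → Adj n
K n u v = not ⌊ u ≟ v ⌋

allFin : (n : ℕ) → List (Fin n)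
allFin n = toList (Data.Vec.allFin n)

-- Valuations f : V → [n].  Vertices are Fin n and the value set
-- [n] = {1,…,n} is represented (order-isomorphically) by Fin n = {0,…,n-1}.

Val : ℕ → Set
Val n = Vec (Fin n) n

maxF : ∀ {n} → Fin n → Fin n → Fin n
maxF a b = if toℕ a ≤ᵇ toℕ b then b else a

nbrMax : ∀ {n} → Adj n → Val n → Fin n → Maybe (Fin n)
nbrMax {n} G f v = foldr comb nothing (allFin n)
  where
  comb : Fin _ → Maybe (Fin _) → Maybe (Fin _)
  comb u acc with G v u ∧ not ⌊ u ≟ v ⌋
  ... | false = acc
  ... | true with acc
  ...   | nothing = just (lookup f u)
  ...   | just m  = just (maxF (lookup f u) m)

step : ∀ {n} → Adj n → Val n → Fin n → Val n
step G f v with nbrMax G f v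
... | nothing = f
... | just m  = f [ v ]≔ m

-- Markov chain of possibilities.  f → g is an edge iff g = step G f v
-- for some vertex v (each vertex is chosen with probability 1/n > 0).

_==V_ : ∀ {n k} → Vec (Fin n) k → Vec (Fin n) k → Bool
[] ==V [] = true
(a ∷ as) ==V (b ∷ bs) = ⌊ a ≟ b ⌋ ∧ (as ==V bs)

allVecs : (n k : ℕ) → List (Vec (Fin n) k)
allVecs n zero = [] ∷ []
allVecs n (suc k) = concatMap (λ x → map (x ∷_) (allVecs n k)) (allFin n)

allVals : (n : ℕ) → List (Val n)
allVals n = allVecs n n

reachWithin : ∀ {n} → Adj n → ℕ → Val n → Val n → Bool
reachWithin G zero f g = f ==V g
reachWithin {n} G (suc k) f g =
  (f ==V g) ∨ any (λ v → reachWithin G k (step G f v) g) (allFin n)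

-- reachability in the Markov chain of possibilities; a graph with n^n
-- vertices has a shortest walk of length < n^n between any reachable pair
reach : ∀ {n} → Adj n → Val n → Val n → Bool
reach {n} G = reachWithin G (n ^ n)

-- f lies in an absorbing component (a strongly connected component with
-- no leaving edge) iff every g reachable from f can reach f back.
absorbing : ∀ {n} → Adj n → Val n → Bool
absorbing {n} G f = all (λ g → not (reach G f g) ∨ reach G g f) (allVals n)

-- Truncated expected absorption time  E[min(Y_f, t)]  (exact rational).
-- T(G,f) = E[Y_f] = sup_t E[min(Y_f,t)] (monotone convergence).

invℕ : ℕ → ℚ
invℕ zero = 0ℚ
invℕ (suc m) = + 1 / suc m

sumℚ : List ℚ → ℚ
sumℚ = foldr _+_ 0ℚ

truncTime : ∀ {n} → Adj n → ℕ → Val n → ℚ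
truncTime G zero f = 0ℚ
truncTime {n} G (suc t) f =
  if absorbing G f then 0ℚ
  else 1ℚ + invℕ n * sumℚ (map (λ v → truncTime G t (step G f v)) (allFin n))

-- On K_n a chosen vertex copies the largest value among the other vertices. Let
-- the deficit d of a valuation be the number of vertices below its maximum value.
-- A vertex below the maximum catches up, so d drops by one; a maximal vertex
-- changes nothing unless it is the unique maximum. Hence the absorbing valuations
-- are the constant ones, and d behaves like a coupon collector succeeding with
-- probability d/n per round. At every non-absorbing valuation the potential n·H_d
-- (H the harmonic numbers) is at least one plus its average over the n equally
-- likely next valuations, so it bounds every truncated expected time, and
-- n·H_n ≤ 2 n log₂ n. As long as two vertices are maximal, which the process then
-- preserves, min(½·n·H_d, ½·t) is at most one plus the average of its value at
-- t − 1, so it bounds the time truncated at t from below; two maximal vertices,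
-- d = n − 2 and t = n log₂ n give ¼ n log₂ n.

module Submission where

open import Defs
open import Data.Nat using (ℕ; _≥_)
open import Data.Nat.Logarithm using (⌊log₂_⌋)
open import Data.Integer using (+_)
open import Data.Rational using (ℚ; 0ℚ; _<_; _≤_; _*_; _/_)
open import Data.Product using (Σ; _×_; ∃; ∃-syntax)

import Data.Nat as ℕ
import Data.Nat.Properties as ℕ
open import Data.Nat using (zero; suc; z≤n; s≤s)
open import Data.Nat.Induction using (<-rec)
open import Data.Nat.Logarithm using (⌊log₂⌋-mono-≤; ⌊log₂⌊n/2⌋⌋≡⌊log₂n⌋∸1)
import Data.Integer as ℤ
import Data.Integer.Properties as ℤ
open import Data.Rational using (1ℚ; _+_; _-_; -_; _⊓_; toℚᵘ; nonNegative)
import Data.Rational.Properties as ℚ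
open import Data.Rational.Unnormalised using (mkℚᵘ; *≡*; *≤*) renaming (_≃_ to _≃ᵘ_)
import Data.Rational.Unnormalised as ℚᵘ
import Data.Rational.Unnormalised.Properties as ℚᵘ
open import Data.Rational.Solver using (module +-*-Solver)
open import Data.Product using (_,_; proj₁; proj₂)
open import Function using (_∘_)
open import Data.Sum using (_⊎_; inj₁; inj₂)
open import Data.Bool using (Bool; true; false; if_then_else_; not; _∨_; T)
import Data.Bool.Properties as Bool
open import Data.Empty using (⊥-elim)
open import Data.Unit using (tt)
open import Data.Fin using (Fin; zero; suc; toℕ)
import Data.Fin.Properties as Fin
open import Data.Fin.Properties using (_≟_)
open import Data.Vec using (Vec; []; _∷_; lookup; _[_]≔_; replicate)
import Data.Vec.Properties as Vec
open import Data.List using (List; []; _∷_; foldr; map)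
import Data.List.Properties as List
open import Data.List.Membership.Propositional using (_∈_)
open import Data.List.Relation.Unary.Any using (here; there)
import Data.List.Membership.Propositional.Properties as List
open import Data.Bool.ListAction using (all; any)
import Data.Vec.Membership.Propositional.Properties as Vec
open import Data.Maybe using (Maybe; just; nothing)
open import Relation.Nullary using (Dec; yes; no)
open import Relation.Nullary.Decidable using (⌊_⌋; ¬?; _×-dec_)
open import Relation.Binary.PropositionalEquality

-- Written as in the statement, so that its bounds `+ m / 1` are `ι m`.
ι : ℕ → ℚ
ι n = + n / 1

½ : ℚ
½ = invℕ 2

private
  ι-≃ : ∀ n → toℚᵘ (ι n) ≃ᵘ mkℚᵘ (+ n) 0
  ι-≃ n = ℚ.toℚᵘ-fromℚᵘ (mkℚᵘ (+ n) 0)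

  invℕ-≃ : ∀ m → toℚᵘ (invℕ (suc m)) ≃ᵘ mkℚᵘ (+ 1) m
  invℕ-≃ m = ℚ.toℚᵘ-fromℚᵘ (mkℚᵘ (+ 1) m)

ι-+ : ∀ a b → ι (a ℕ.+ b) ≡ ι a + ι b
ι-+ a b = ℚ.toℚᵘ-injective (begin
  toℚᵘ (ι (a ℕ.+ b))             ≈⟨ ι-≃ (a ℕ.+ b) ⟩
  mkℚᵘ (+ (a ℕ.+ b)) 0            ≈⟨ *≡* (cong (ℤ._* + 1)
                                       (trans (ℤ.pos-+ a b) (sym (cong₂ ℤ._+_ (ℤ.*-identityʳ (+ a)) (ℤ.*-identityʳ (+ b)))))) ⟩
  mkℚᵘ (+ a) 0 ℚᵘ.+ mkℚᵘ (+ b) 0  ≈⟨ ℚᵘ.+-cong (ι-≃ a) (ι-≃ b) ⟨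
  toℚᵘ (ι a) ℚᵘ.+ toℚᵘ (ι b)      ≈⟨ ℚ.toℚᵘ-homo-+ (ι a) (ι b) ⟨
  toℚᵘ (ι a + ι b)                ∎)
  where open ℚᵘ.≃-Reasoning

ι-* : ∀ a b → ι (a ℕ.* b) ≡ ι a * ι b
ι-* a b = ℚ.toℚᵘ-injective (begin
  toℚᵘ (ι (a ℕ.* b))             ≈⟨ ι-≃ (a ℕ.* b) ⟩
  mkℚᵘ (+ (a ℕ.* b)) 0            ≈⟨ *≡* (cong (ℤ._* + 1) (ℤ.pos-* a b)) ⟩
  mkℚᵘ (+ a) 0 ℚᵘ.* mkℚᵘ (+ b) 0  ≈⟨ ℚᵘ.*-cong (ι-≃ a) (ι-≃ b) ⟨
  toℚᵘ (ι a) ℚᵘ.* toℚᵘ (ι b)      ≈⟨ ℚ.toℚᵘ-homo-* (ι a) (ι b) ⟨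
  toℚᵘ (ι a * ι b)                ∎)
  where open ℚᵘ.≃-Reasoning

invℕ-inverseˡ : ∀ m → invℕ (suc m) * ι (suc m) ≡ 1ℚ
invℕ-inverseˡ m = ℚ.toℚᵘ-injective (begin
  toℚᵘ (invℕ (suc m) * ι (suc m))             ≈⟨ ℚ.toℚᵘ-homo-* (invℕ (suc m)) (ι (suc m)) ⟩
  toℚᵘ (invℕ (suc m)) ℚᵘ.* toℚᵘ (ι (suc m))   ≈⟨ ℚᵘ.*-cong (invℕ-≃ m) (ι-≃ (suc m)) ⟩
  mkℚᵘ (+ 1) m ℚᵘ.* mkℚᵘ (+ suc m) 0           ≈⟨ *≡* (trans (ℤ.*-identityʳ _) (trans (ℤ.*-identityˡ (+ suc m))
                                                      (sym (trans (ℤ.*-identityˡ _) (cong (λ d → + suc d) (ℕ.*-identityʳ m)))))) ⟩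
  toℚᵘ 1ℚ                                      ∎)
  where open ℚᵘ.≃-Reasoning

ι*invℕ≡1 : ∀ m → ι (suc m) * invℕ (suc m) ≡ 1ℚ
ι*invℕ≡1 m = trans (ℚ.*-comm (ι (suc m)) (invℕ (suc m))) (invℕ-inverseˡ m)

ι-mono-≤ : ∀ {a b} → a ℕ.≤ b → ι a ≤ ι b
ι-mono-≤ {a} {b} a≤b = ℚ.toℚᵘ-cancel-≤
  (ℚᵘ.≤-respʳ-≃ (ℚᵘ.≃-sym (ι-≃ b)) (ℚᵘ.≤-respˡ-≃ (ℚᵘ.≃-sym (ι-≃ a))
  (*≤* (ℤ.*-monoʳ-≤-nonNeg (+ 1) (ℤ.+≤+ a≤b)))))

invℕ-antimono-≤ : ∀ {a b} → a ℕ.≤ b → invℕ (suc b) ≤ invℕ (suc a)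
invℕ-antimono-≤ {a} {b} a≤b = ℚ.toℚᵘ-cancel-≤
  (ℚᵘ.≤-respʳ-≃ (ℚᵘ.≃-sym (invℕ-≃ a)) (ℚᵘ.≤-respˡ-≃ (ℚᵘ.≃-sym (invℕ-≃ b))
  (*≤* (ℤ.*-monoˡ-≤-nonNeg (+ 1) (ℤ.+≤+ (s≤s a≤b))))))

0≤ι : ∀ n → 0ℚ ≤ ι n
0≤ι n = ι-mono-≤ {0} {n} z≤n

0≤invℕ : ∀ n → 0ℚ ≤ invℕ n
0≤invℕ zero = ℚ.≤-refl
0≤invℕ (suc m) = ℚ.nonNegative⁻¹ _ {{ℚ.normalize-nonNeg 1 (suc m)}}

0≤½ : 0ℚ ≤ ½
0≤½ = 0≤invℕ 2

*-monoˡ-≤-0≤ : ∀ {r p q} → 0ℚ ≤ r → p ≤ q → r * p ≤ r * q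
*-monoˡ-≤-0≤ {r} 0≤r = ℚ.*-monoˡ-≤-nonNeg r {{nonNegative 0≤r}}

*-monoʳ-≤-0≤ : ∀ {r p q} → 0ℚ ≤ r → p ≤ q → p * r ≤ q * r
*-monoʳ-≤-0≤ {r} 0≤r = ℚ.*-monoʳ-≤-nonNeg r {{nonNegative 0≤r}}

0≤* : ∀ {p q} → 0ℚ ≤ p → 0ℚ ≤ q → 0ℚ ≤ p * q
0≤* {p} {q} 0≤p 0≤q = ℚ.≤-trans (ℚ.≤-reflexive (sym (ℚ.*-zeroˡ q))) (*-monoʳ-≤-0≤ 0≤q 0≤p)

0≤+ : ∀ {p q} → 0ℚ ≤ p → 0ℚ ≤ q → 0ℚ ≤ p + q
0≤+ = ℚ.+-mono-≤

p≤p+q : ∀ {p q} → 0ℚ ≤ q → p ≤ p + q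
p≤p+q {p} 0≤q = ℚ.≤-trans (ℚ.≤-reflexive (sym (ℚ.+-identityʳ p))) (ℚ.+-monoʳ-≤ p 0≤q)

⊓-+-≤ : ∀ x y {h} → 0ℚ ≤ h → x ⊓ (y + h) ≤ (x ⊓ y) + h
⊓-+-≤ x y {h} 0≤h with ℚ.≤-total x y
... | inj₁ x≤y rewrite ℚ.p≤q⇒p⊓q≡p x≤y = ℚ.≤-trans (ℚ.p⊓q≤p x (y + h)) (p≤p+q 0≤h)
... | inj₂ y≤x rewrite ℚ.p≥q⇒p⊓q≡q y≤x = ℚ.p⊓q≤q x (y + h)

ι-suc : ∀ n → ι (suc n) ≡ 1ℚ + ι n
ι-suc = ι-+ 1

½*ι-suc : ∀ n → ½ * ι (suc n) ≡ ½ * ι n + ½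
½*ι-suc n = trans (cong (½ *_) (ι-suc n)) (solve 1 (λ x → con ½ :* (con 1ℚ :+ x) := con ½ :* x :+ con ½) refl (ι n))
  where open +-*-Solver

harmonic : ℕ → ℚ
harmonic zero = 0ℚ
harmonic (suc m) = harmonic m + invℕ (suc m)

0≤harmonic : ∀ m → 0ℚ ≤ harmonic m
0≤harmonic zero = ℚ.≤-refl
0≤harmonic (suc m) = 0≤+ (0≤harmonic m) (0≤invℕ (suc m))

harmonic-mono-≤ : ∀ {a b} → a ℕ.≤ b → harmonic a ≤ harmonic b
harmonic-mono-≤ a≤b = mono′ (ℕ.≤⇒≤′ a≤b)
  where
  mono′ : ∀ {a b} → a ℕ.≤′ b → harmonic a ≤ harmonic b
  mono′ ℕ.≤′-refl = ℚ.≤-refl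
  mono′ (ℕ.≤′-step {n} a≤′n) = ℚ.≤-trans (mono′ a≤′n) (p≤p+q (0≤invℕ (suc n)))

private
  h+ιd*i+i≡h+ι[1+d]*i : ∀ h d i → h + ι d * i + i ≡ h + ι (suc d) * i
  h+ιd*i+i≡h+ι[1+d]*i h d i = trans (regroup h (ι d) i) (cong (λ x → h + x * i) (sym (ι-suc d)))
    where
    open +-*-Solver
    regroup : ∀ h x i → h + x * i + i ≡ h + (1ℚ + x) * i
    regroup = solve 3 (λ h x i → h :+ x :* i :+ i := h :+ (con 1ℚ :+ x) :* i) refl

  h+ι0*i≡h : ∀ h i → h + ι 0 * i ≡ h
  h+ι0*i≡h = solve 2 (λ h i → h :+ con 0ℚ :* i := h) refl
    where open +-*-Solver

harmonic-+-≤ : ∀ m d → harmonic (m ℕ.+ d) ≤ harmonic m + ι d * invℕ (suc m)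
harmonic-+-≤ m zero = ℚ.≤-reflexive (trans (cong harmonic (ℕ.+-identityʳ m)) (sym (h+ι0*i≡h (harmonic m) (invℕ (suc m)))))
harmonic-+-≤ m (suc d) = begin
  harmonic (m ℕ.+ suc d)                                     ≡⟨ cong harmonic (ℕ.+-suc m d) ⟩
  harmonic (m ℕ.+ d) + invℕ (suc (m ℕ.+ d))                  ≤⟨ ℚ.+-mono-≤ (harmonic-+-≤ m d) (invℕ-antimono-≤ (ℕ.m≤m+n m d)) ⟩
  harmonic m + ι d * invℕ (suc m) + invℕ (suc m)             ≡⟨ h+ιd*i+i≡h+ι[1+d]*i (harmonic m) d (invℕ (suc m)) ⟩
  harmonic m + ι (suc d) * invℕ (suc m)                      ∎
  where open ℚ.≤-Reasoning

harmonic-+-≥ : ∀ m d K → m ℕ.+ d ℕ.≤ suc K → harmonic m + ι d * invℕ (suc K) ≤ harmonic (m ℕ.+ d)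
harmonic-+-≥ m zero K _ = ℚ.≤-reflexive (trans (h+ι0*i≡h (harmonic m) (invℕ (suc K))) (cong harmonic (sym (ℕ.+-identityʳ m))))
harmonic-+-≥ m (suc d) K m+1+d≤1+K = begin
  harmonic m + ι (suc d) * invℕ (suc K)                      ≡⟨ h+ιd*i+i≡h+ι[1+d]*i (harmonic m) d (invℕ (suc K)) ⟨
  harmonic m + ι d * invℕ (suc K) + invℕ (suc K)             ≤⟨ ℚ.+-mono-≤ (harmonic-+-≥ m d K (ℕ.<⇒≤ m+d<1+K)) (invℕ-antimono-≤ (ℕ.≤-pred m+d<1+K)) ⟩
  harmonic (m ℕ.+ d) + invℕ (suc (m ℕ.+ d))                  ≡⟨ cong harmonic (ℕ.+-suc m d) ⟨
  harmonic (m ℕ.+ suc d)                                     ∎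
  where
  open ℚ.≤-Reasoning
  m+d<1+K : m ℕ.+ d ℕ.< suc K
  m+d<1+K = subst (ℕ._≤ suc K) (ℕ.+-suc m d) m+1+d≤1+K

⌈n/2⌉≤1+⌊n/2⌋ : ∀ n → ℕ.⌈ n /2⌉ ℕ.≤ suc ℕ.⌊ n /2⌋
⌈n/2⌉≤1+⌊n/2⌋ n = ℕ.⌊n/2⌋-mono (ℕ.n≤1+n (suc n))

harmonic-≤-half+1 : ∀ j → harmonic j ≤ harmonic ℕ.⌊ j /2⌋ + 1ℚ
harmonic-≤-half+1 j = begin
  harmonic j                                ≡⟨ cong harmonic (ℕ.⌊n/2⌋+⌈n/2⌉≡n j) ⟨
  harmonic (m ℕ.+ d)                        ≤⟨ harmonic-+-≤ m d ⟩
  harmonic m + ι d * invℕ (suc m)           ≤⟨ ℚ.+-monoʳ-≤ (harmonic m) (*-monoʳ-≤-0≤ (0≤invℕ (suc m)) (ι-mono-≤ (⌈n/2⌉≤1+⌊n/2⌋ j))) ⟩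
  harmonic m + ι (suc m) * invℕ (suc m)     ≡⟨ cong (λ x → harmonic m + x) (ι*invℕ≡1 m) ⟩
  harmonic m + 1ℚ                           ∎
  where
  open ℚ.≤-Reasoning
  m = ℕ.⌊ j /2⌋
  d = ℕ.⌈ j /2⌉

ι*invℕ[2ι]≡½ : ∀ m → ι (suc m) * invℕ (suc m ℕ.+ suc m) ≡ ½
ι*invℕ[2ι]≡½ m = begin
  x * i                     ≡⟨ halve x i ⟩
  ½ * ((x + x) * i)         ≡⟨ cong (λ y → ½ * (y * i)) (ι-+ (suc m) (suc m)) ⟨
  ½ * (ι (suc m ℕ.+ suc m) * i)  ≡⟨ cong (½ *_) (ι*invℕ≡1 (m ℕ.+ suc m)) ⟩
  ½ * 1ℚ                    ≡⟨ ℚ.*-identityʳ ½ ⟩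
  ½                         ∎
  where
  open ≡-Reasoning
  open +-*-Solver
  x = ι (suc m)
  i = invℕ (suc m ℕ.+ suc m)
  halve : ∀ x i → x * i ≡ ½ * ((x + x) * i)
  halve = solve 2 (λ x i → x :* i := con ½ :* ((x :+ x) :* i)) refl

half+½≤harmonic : ∀ i → harmonic (suc ℕ.⌊ i /2⌋) + ½ ≤ harmonic (2 ℕ.+ i)
half+½≤harmonic i = begin
  harmonic m + ½                                  ≡⟨ cong (λ x → harmonic m + x) (ι*invℕ[2ι]≡½ ℕ.⌊ i /2⌋) ⟨
  harmonic m + ι m * invℕ (m ℕ.+ m)               ≤⟨ harmonic-+-≥ m m _ ℕ.≤-refl ⟩
  harmonic (m ℕ.+ m)                              ≤⟨ harmonic-mono-≤ (ℕ.+-monoʳ-≤ m (ℕ.⌊n/2⌋≤⌈n/2⌉ (2 ℕ.+ i))) ⟩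
  harmonic (m ℕ.+ ℕ.⌈ 2 ℕ.+ i /2⌉)                ≡⟨ cong harmonic (ℕ.⌊n/2⌋+⌈n/2⌉≡n (2 ℕ.+ i)) ⟩
  harmonic (2 ℕ.+ i)                              ∎
  where
  open ℚ.≤-Reasoning
  m = suc ℕ.⌊ i /2⌋

⌊log₂⌋-halve : ∀ i → ⌊log₂ (2 ℕ.+ i) ⌋ ≡ suc ⌊log₂ suc ℕ.⌊ i /2⌋ ⌋
⌊log₂⌋-halve i = cong suc (sym (⌊log₂⌊n/2⌋⌋≡⌊log₂n⌋∸1 (2 ℕ.+ i)))

halving-induction : (P : ℕ → Set) → P 1 → (∀ i → P (suc ℕ.⌊ i /2⌋) → P (2 ℕ.+ i)) → ∀ j → 1 ℕ.≤ j → P j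
halving-induction P base from-half = <-rec (λ j → 1 ℕ.≤ j → P j) go
  where
  go : ∀ j → (∀ {i} → i ℕ.< j → 1 ℕ.≤ i → P i) → 1 ℕ.≤ j → P j
  go 1 _ _ = base
  go (suc (suc i)) rec _ = from-half i (rec (ℕ.⌊n/2⌋<n (suc i)) (s≤s z≤n))

harmonic-≤-log : ∀ j → 1 ℕ.≤ j → harmonic j ≤ ι ⌊log₂ j ⌋ + 1ℚ
harmonic-≤-log = halving-induction (λ j → harmonic j ≤ ι ⌊log₂ j ⌋ + 1ℚ) (ℚ.≤ᵇ⇒≤ _) from-half
  where
  from-half : ∀ i → harmonic (suc ℕ.⌊ i /2⌋) ≤ ι ⌊log₂ suc ℕ.⌊ i /2⌋ ⌋ + 1ℚ →
                    harmonic (2 ℕ.+ i) ≤ ι ⌊log₂ (2 ℕ.+ i) ⌋ + 1ℚ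
  from-half i ih = begin
    harmonic (2 ℕ.+ i)            ≤⟨ harmonic-≤-half+1 (2 ℕ.+ i) ⟩
    harmonic m + 1ℚ               ≤⟨ ℚ.+-monoˡ-≤ 1ℚ ih ⟩
    ι ⌊log₂ m ⌋ + 1ℚ + 1ℚ          ≡⟨ cong (_+ 1ℚ) (trans (ℚ.+-comm (ι ⌊log₂ m ⌋) 1ℚ) (sym (ι-suc ⌊log₂ m ⌋))) ⟩
    ι (suc ⌊log₂ m ⌋) + 1ℚ         ≡⟨ cong (λ l → ι l + 1ℚ) (⌊log₂⌋-halve i) ⟨
    ι ⌊log₂ (2 ℕ.+ i) ⌋ + 1ℚ       ∎
    where
    open ℚ.≤-Reasoning
    m = suc ℕ.⌊ i /2⌋

log-≤-harmonic : ∀ j → 1 ℕ.≤ j → ½ * ι (suc ⌊log₂ j ⌋) ≤ harmonic j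
log-≤-harmonic = halving-induction (λ j → ½ * ι (suc ⌊log₂ j ⌋) ≤ harmonic j) (ℚ.≤ᵇ⇒≤ _) from-half
  where
  from-half : ∀ i → ½ * ι (suc ⌊log₂ suc ℕ.⌊ i /2⌋ ⌋) ≤ harmonic (suc ℕ.⌊ i /2⌋) →
                    ½ * ι (suc ⌊log₂ (2 ℕ.+ i) ⌋) ≤ harmonic (2 ℕ.+ i)
  from-half i ih = begin
    ½ * ι (suc ⌊log₂ (2 ℕ.+ i) ⌋)      ≡⟨ cong (λ l → ½ * ι (suc l)) (⌊log₂⌋-halve i) ⟩
    ½ * ι (suc (suc ⌊log₂ m ⌋))         ≡⟨ ½*ι-suc (suc ⌊log₂ m ⌋) ⟩
    ½ * ι (suc ⌊log₂ m ⌋) + ½           ≤⟨ ℚ.+-monoˡ-≤ ½ ih ⟩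
    harmonic m + ½                      ≤⟨ half+½≤harmonic i ⟩
    harmonic (2 ℕ.+ i)                  ∎
    where
    open ℚ.≤-Reasoning
    m = suc ℕ.⌊ i /2⌋

-- Reachability and absorption

∈-allFin : ∀ {n} (u : Fin n) → u ∈ allFin n
∈-allFin u = Vec.∈-toList⁺ (Vec.∈-allFin⁺ u)

false≢true : false ≢ true
false≢true ()

any-true : ∀ {a} {A : Set a} (p : A → Bool) {x} xs → x ∈ xs → p x ≡ true → any p xs ≡ true
any-true p (y ∷ xs) (here refl) px rewrite px = refl
any-true p (y ∷ xs) (there x∈xs) px rewrite any-true p xs x∈xs px = Bool.∨-zeroʳ (p y)

any-const : ∀ {a} {A : Set a} (p : A → Bool) b xs → (∀ x → p x ≡ b) → b ∨ any p xs ≡ b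
any-const p true xs _ = refl
any-const p false [] _ = refl
any-const p false (y ∷ xs) p≡false rewrite p≡false y = any-const p false xs p≡false

all-true : ∀ {a} {A : Set a} (p : A → Bool) xs → (∀ x → p x ≡ true) → all p xs ≡ true
all-true p [] _ = refl
all-true p (y ∷ xs) p≡true rewrite p≡true y = all-true p xs p≡true

all-false : ∀ {a} {A : Set a} (p : A → Bool) {x} xs → x ∈ xs → p x ≡ false → all p xs ≡ false
all-false p (y ∷ xs) (here refl) px rewrite px = refl
all-false p (y ∷ xs) (there x∈xs) px rewrite all-false p xs x∈xs px = Bool.∧-zeroʳ (p y)

==V-refl : ∀ {n k} (x : Vec (Fin n) k) → (x ==V x) ≡ true
==V-refl [] = refl
==V-refl (a ∷ x) with a ≟ a
... | yes _ = ==V-refl x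
... | no a≢a = ⊥-elim (a≢a refl)

==V-sound : ∀ {n k} {x y : Vec (Fin n) k} → (x ==V y) ≡ true → x ≡ y
==V-sound {x = []} {[]} _ = refl
==V-sound {x = a ∷ x} {b ∷ y} x==y with a ≟ b
... | yes refl = cong (a ∷_) (==V-sound x==y)

∈-allVecs : ∀ n k (x : Vec (Fin n) k) → x ∈ allVecs n k
∈-allVecs n zero [] = here refl
∈-allVecs n (suc k) (a ∷ x) =
  List.∈-concat⁺′ (List.∈-map⁺ (a ∷_) (∈-allVecs n k x)) (List.∈-map⁺ (λ b → map (b ∷_) (allVecs n k)) (∈-allFin a))

reachWithin-refl : ∀ {n} (G : Adj n) s g → reachWithin G s g g ≡ true
reachWithin-refl G zero g = ==V-refl g
reachWithin-refl G (suc s) g rewrite ==V-refl g = refl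

Fixed : ∀ {n} → Adj n → Val n → Set
Fixed G f = ∀ v → step G f v ≡ f

reachWithin-from-fixed : ∀ {n} (G : Adj n) {f} → Fixed G f → ∀ s g → reachWithin G s f g ≡ (f ==V g)
reachWithin-from-fixed G fixed zero g = refl
reachWithin-from-fixed {n} G {f} fixed (suc s) g = any-const _ (f ==V g) (allFin n)
  (λ v → trans (cong (λ h → reachWithin G s h g) (fixed v)) (reachWithin-from-fixed G fixed s g))

fixed⇒absorbing : ∀ {n} (G : Adj n) {f} → Fixed G f → absorbing G f ≡ true
fixed⇒absorbing {n} G {f} fixed = all-true _ (allVals n) reachable-returns
  where
  reachable-returns : ∀ g → (not (reach G f g) ∨ reach G g f) ≡ true
  reachable-returns g rewrite reachWithin-from-fixed G fixed (n ℕ.^ n) g with f ==V g in f==g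
  ... | false = refl
  ... | true = subst (λ h → reach G g h ≡ true) (sym (==V-sound f==g)) (reachWithin-refl G (n ℕ.^ n) g)

reaches-fixed⇒not-absorbing : ∀ {n} (G : Adj n) {f g} → Fixed G g → reach G f g ≡ true → g ≢ f → absorbing G f ≡ false
reaches-fixed⇒not-absorbing {n} G {f} {g} fixed f→g g≢f = all-false _ (allVals n) (∈-allVecs n n g) no-return
  where
  g↛f : reach G g f ≡ false
  g↛f rewrite reachWithin-from-fixed G fixed (n ℕ.^ n) f with g ==V f in g==f
  ... | false = refl
  ... | true = ⊥-elim (g≢f (==V-sound g==f))
  no-return : (not (reach G f g) ∨ reach G g f) ≡ false
  no-return rewrite f→g | g↛f = refl

n≤n^n : ∀ n → n ℕ.≤ n ℕ.^ n
n≤n^n zero = z≤n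
n≤n^n (suc n) = ℕ.m≤m*n (suc n) (suc n ℕ.^ n) {{ℕ.m^n≢0 (suc n) n}}

-- Maximum value and deficit of a valuation

isAt : ∀ {n} → ℕ → Fin n → Bool
isAt M a = ⌊ toℕ a ℕ.≟ M ⌋

isAt-true : ∀ {n} M (a : Fin n) → toℕ a ≡ M → isAt M a ≡ true
isAt-true M a a≡M with toℕ a ℕ.≟ M
... | yes _ = refl
... | no a≢M = ⊥-elim (a≢M a≡M)

isAt-false : ∀ {n} M (a : Fin n) → toℕ a ≢ M → isAt M a ≡ false
isAt-false M a a≢M with toℕ a ℕ.≟ M
... | yes a≡M = ⊥-elim (a≢M a≡M)
... | no _ = refl

maxValue : ∀ {n k} → Vec (Fin n) k → ℕ
maxValue [] = 0
maxValue (a ∷ f) = toℕ a ℕ.⊔ maxValue f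

countAt : ∀ {n k} → ℕ → Vec (Fin n) k → ℕ
countAt M [] = 0
countAt M (a ∷ f) = if isAt M a then suc (countAt M f) else countAt M f

countOff : ∀ {n k} → ℕ → Vec (Fin n) k → ℕ
countOff M [] = 0
countOff M (a ∷ f) = if isAt M a then countOff M f else suc (countOff M f)

deficit : ∀ {n k} → Vec (Fin n) k → ℕ
deficit f = countOff (maxValue f) f

lookup-≤-maxValue : ∀ {n k} (f : Vec (Fin n) k) i → toℕ (lookup f i) ℕ.≤ maxValue f
lookup-≤-maxValue (a ∷ f) zero = ℕ.m≤m⊔n (toℕ a) (maxValue f)
lookup-≤-maxValue (a ∷ f) (suc i) = ℕ.≤-trans (lookup-≤-maxValue f i) (ℕ.m≤n⊔m (toℕ a) (maxValue f))

maxValue-≤ : ∀ {n k} (f : Vec (Fin n) k) {B} → (∀ i → toℕ (lookup f i) ℕ.≤ B) → maxValue f ℕ.≤ B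
maxValue-≤ [] _ = z≤n
maxValue-≤ (a ∷ f) f≤B = ℕ.⊔-lub (f≤B zero) (maxValue-≤ f (λ i → f≤B (suc i)))

maxValue-attained : ∀ {n k} (f : Vec (Fin n) (suc k)) → ∃[ i ] toℕ (lookup f i) ≡ maxValue f
maxValue-attained {k = zero} (a ∷ []) = zero , sym (ℕ.⊔-identityʳ (toℕ a))
maxValue-attained {k = suc k} (a ∷ f) with ℕ.⊔-sel (toℕ a) (maxValue f) | maxValue-attained f
... | inj₁ a⊔≡a | _ = zero , sym a⊔≡a
... | inj₂ a⊔≡m | i , fi≡m = suc i , trans fi≡m (sym a⊔≡m)

maxValue-unique : ∀ {n k} (f : Vec (Fin n) k) {B} → (∀ i → toℕ (lookup f i) ℕ.≤ B) → ∃[ i ] toℕ (lookup f i) ≡ B → maxValue f ≡ B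
maxValue-unique f f≤B (i , fi≡B) = ℕ.≤-antisym (maxValue-≤ f f≤B) (subst (ℕ._≤ maxValue f) fi≡B (lookup-≤-maxValue f i))

countAt+countOff : ∀ {n k} M (f : Vec (Fin n) k) → countAt M f ℕ.+ countOff M f ≡ k
countAt+countOff M [] = refl
countAt+countOff M (a ∷ f) with isAt M a
... | true = cong suc (countAt+countOff M f)
... | false = trans (ℕ.+-suc (countAt M f) (countOff M f)) (cong suc (countAt+countOff M f))

1≤countAt : ∀ {n k} M (f : Vec (Fin n) k) i → toℕ (lookup f i) ≡ M → 1 ℕ.≤ countAt M f
1≤countAt M (a ∷ f) zero a≡M rewrite isAt-true M a a≡M = s≤s z≤n
1≤countAt M (a ∷ f) (suc i) fi≡M with isAt M a
... | true = s≤s z≤n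
... | false = 1≤countAt M f i fi≡M

countAt≡0 : ∀ {n k} M (f : Vec (Fin n) k) → (∀ i → toℕ (lookup f i) ≢ M) → countAt M f ≡ 0
countAt≡0 M [] _ = refl
countAt≡0 M (a ∷ f) f≢M rewrite isAt-false M a (f≢M zero) = countAt≡0 M f (λ i → f≢M (suc i))

countAt≤1 : ∀ {n k} M (f : Vec (Fin n) k) v → (∀ w → w ≢ v → toℕ (lookup f w) ≢ M) → countAt M f ℕ.≤ 1
countAt≤1 M (a ∷ f) zero others≢M with isAt M a
... | true = s≤s (ℕ.≤-reflexive (countAt≡0 M f (λ w → others≢M (suc w) (λ ()))))
... | false = subst (ℕ._≤ 1) (sym (countAt≡0 M f (λ w → others≢M (suc w) (λ ())))) z≤n
countAt≤1 M (a ∷ f) (suc v) others≢M rewrite isAt-false M a (others≢M zero (λ ())) =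
  countAt≤1 M f v (λ w w≢v → others≢M (suc w) (w≢v ∘ Fin.suc-injective))

countOff-≤ : ∀ {n k} M (f : Vec (Fin n) (suc k)) i → toℕ (lookup f i) ≡ M → countOff M f ℕ.≤ k
countOff-≤ M f i fi≡M = ℕ.+-cancelˡ-≤ 1 _ _ (subst (1 ℕ.+ countOff M f ℕ.≤_) (countAt+countOff M f)
  (ℕ.+-monoˡ-≤ (countOff M f) (1≤countAt M f i fi≡M)))

deficit-≤ : ∀ {n k} (f : Vec (Fin n) (suc k)) → deficit f ℕ.≤ k
deficit-≤ f = countOff-≤ (maxValue f) f (proj₁ (maxValue-attained f)) (proj₂ (maxValue-attained f))

countOff-update : ∀ {n k} M (f : Vec (Fin n) k) v x → toℕ (lookup f v) ≢ M → toℕ x ≡ M →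
  suc (countOff M (f [ v ]≔ x)) ≡ countOff M f
countOff-update M (a ∷ f) zero x a≢M x≡M rewrite isAt-false M a a≢M | isAt-true M x x≡M = refl
countOff-update M (a ∷ f) (suc v) x fv≢M x≡M with isAt M a
... | true = countOff-update M f v x fv≢M x≡M
... | false = cong suc (countOff-update M f v x fv≢M x≡M)

countOff≡0 : ∀ {n k} M (f : Vec (Fin n) k) → countOff M f ≡ 0 → ∀ i → toℕ (lookup f i) ≡ M
countOff≡0 M (a ∷ f) f≡0 i with toℕ a ℕ.≟ M
countOff≡0 M (a ∷ f) f≡0 zero | yes a≡M = a≡M
countOff≡0 M (a ∷ f) f≡0 (suc i) | yes _ = countOff≡0 M f f≡0 i
countOff≡0 M (a ∷ f) () i | no _

countOff≢0 : ∀ {n k} M (f : Vec (Fin n) k) → countOff M f ≢ 0 → ∃[ i ] toℕ (lookup f i) ≢ M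
countOff≢0 M [] f≢0 = ⊥-elim (f≢0 refl)
countOff≢0 M (a ∷ f) f≢0 with toℕ a ℕ.≟ M
... | no a≢M = zero , a≢M
... | yes _ with countOff≢0 M f f≢0
...   | i , fi≢M = suc i , fi≢M

lookup-const⇒replicate : ∀ {a} {A : Set a} {k} (f : Vec A k) x → (∀ i → lookup f i ≡ x) → f ≡ replicate k x
lookup-const⇒replicate [] x _ = refl
lookup-const⇒replicate (a ∷ f) x f≡x = cong₂ _∷_ (f≡x zero) (lookup-const⇒replicate f x (λ i → f≡x (suc i)))

deficit-replicate : ∀ {n k} (x : Fin n) → deficit (replicate (suc k) x) ≡ 0
deficit-replicate {k = k} x rewrite maxValue-unique (replicate (suc k) x) {toℕ x}
  (λ i → ℕ.≤-reflexive (cong toℕ (Vec.lookup-replicate i x))) (zero , refl) = countOff-replicate (suc k)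
  where
  countOff-replicate : ∀ j → countOff (toℕ x) (replicate j x) ≡ 0
  countOff-replicate zero = refl
  countOff-replicate (suc j) rewrite isAt-true (toℕ x) x refl = countOff-replicate j

maxF-sel : ∀ {n} (a b : Fin n) → maxF a b ≡ a ⊎ maxF a b ≡ b
maxF-sel a b with toℕ a ℕ.≤ᵇ toℕ b
... | true = inj₂ refl
... | false = inj₁ refl

maxF-≥ : ∀ {n} (a b : Fin n) → toℕ a ℕ.≤ toℕ (maxF a b) × toℕ b ℕ.≤ toℕ (maxF a b)
maxF-≥ a b with toℕ a ℕ.≤ᵇ toℕ b in a≤ᵇb
... | true = ℕ.≤ᵇ⇒≤ (toℕ a) (toℕ b) (subst T (sym a≤ᵇb) tt) , ℕ.≤-refl
... | false = ℕ.≤-refl , ℕ.<⇒≤ (ℕ.≰⇒> λ a≤b → subst T a≤ᵇb (ℕ.≤⇒≤ᵇ a≤b))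

IsMaxOn : ∀ {n} → Val n → (Fin n → Set) → Fin n → Set
IsMaxOn f P m = (∃[ u ] P u × lookup f u ≡ m) × (∀ u → P u → toℕ (lookup f u) ℕ.≤ toℕ m)

-- `nbrMax` folds a function local to its definition; unification against the unfolding of `nbrMax` names it.
nbrMax-foldr : ∀ {n} (G : Adj n) f v → ∃[ c ] nbrMax G f v ≡ foldr c nothing (allFin n)
nbrMax-foldr G f v = _ , refl

private
  combine : ∀ {n} → Adj n → Val n → Fin n → Fin n → Maybe (Fin n) → Maybe (Fin n)
  combine G f v = proj₁ (nbrMax-foldr G f v)

  insertMax : ∀ {n} → Fin n → Maybe (Fin n) → Maybe (Fin n)
  insertMax a nothing = just a
  insertMax a (just m) = just (maxF a m)

  combine-K-self : ∀ {n} (f : Val n) v u acc → u ≡ v → combine (K n) f v u acc ≡ acc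
  combine-K-self f v .v acc refl with v ≟ v
  ... | yes _ = refl
  ... | no v≢v = ⊥-elim (v≢v refl)

  combine-K-other : ∀ {n} (f : Val n) v u acc → u ≢ v → combine (K n) f v u acc ≡ insertMax (lookup f u) acc
  combine-K-other f v u acc u≢v with u ≟ v | v ≟ u
  ... | yes u≡v | _ = ⊥-elim (u≢v u≡v)
  ... | no _ | yes v≡u = ⊥-elim (u≢v (sym v≡u))
  ... | no _ | no _ with acc
  ...   | nothing = refl
  ...   | just _ = refl

FoldInvariant : ∀ {n} → Val n → Fin n → List (Fin n) → Maybe (Fin n) → Set
FoldInvariant {n} f v us r =
  r ≡ nothing × (∀ u → u ∈ us → u ≡ v) ⊎
  ∃[ m ] r ≡ just m × IsMaxOn f (λ u → u ∈ us × u ≢ v) m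

foldr-combine-K : ∀ {n} (f : Val n) v us → FoldInvariant f v us (foldr (combine (K n) f v) nothing us)
foldr-combine-K f v [] = inj₁ (refl , λ _ ())
foldr-combine-K {n} f v (u ∷ us) = cons (u ≟ v) (foldr-combine-K f v us)
  where
  acc = foldr (combine (K n) f v) nothing us

  extend : ∀ {r} → u ≡ v → FoldInvariant f v us r → FoldInvariant f v (u ∷ us) r
  extend refl (inj₁ (r≡nothing , us≡v)) = inj₁ (r≡nothing , λ { _ (here refl) → refl ; w (there w∈us) → us≡v w w∈us })
  extend refl (inj₂ (m , r≡m , (w , (w∈us , w≢v) , fw≡m) , bound)) = inj₂ (m , r≡m , (w , (there w∈us , w≢v) , fw≡m) ,
    λ { _ (here refl , v≢v) → ⊥-elim (v≢v refl) ; w (there w∈us , w≢v) → bound w (w∈us , w≢v) })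

  insert : ∀ {r} → u ≢ v → FoldInvariant f v us r → FoldInvariant f v (u ∷ us) (insertMax (lookup f u) r)
  insert u≢v (inj₁ (refl , us≡v)) = inj₂ (lookup f u , refl , (u , (here refl , u≢v) , refl) ,
    λ { _ (here refl , _) → ℕ.≤-refl ; w (there w∈us , w≢v) → ⊥-elim (w≢v (us≡v w w∈us)) })
  insert u≢v (inj₂ (m , refl , (w , (w∈us , w≢v) , fw≡m) , bound)) =
    inj₂ (maxF (lookup f u) m , refl , witness (maxF-sel (lookup f u) m) ,
      λ { _ (here refl , _) → proj₁ (maxF-≥ (lookup f u) m)
        ; w (there w∈us , w≢v) → ℕ.≤-trans (bound w (w∈us , w≢v)) (proj₂ (maxF-≥ (lookup f u) m)) })
    where
    witness : maxF (lookup f u) m ≡ lookup f u ⊎ maxF (lookup f u) m ≡ m →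
      ∃[ x ] (x ∈ u ∷ us × x ≢ v) × lookup f x ≡ maxF (lookup f u) m
    witness (inj₁ max≡fu) = u , (here refl , u≢v) , sym max≡fu
    witness (inj₂ max≡m) = w , (there w∈us , w≢v) , trans fw≡m (sym max≡m)

  cons : Dec (u ≡ v) → FoldInvariant f v us acc → FoldInvariant f v (u ∷ us) (combine (K n) f v u acc)
  cons (yes u≡v) ih rewrite combine-K-self f v u acc u≡v = extend u≡v ih
  cons (no u≢v) ih rewrite combine-K-other f v u acc u≢v = insert u≢v ih

-- Averages over the vertices and potentials

sumℚ-mono : ∀ {a} {A : Set a} {g h : A → ℚ} xs → (∀ x → g x ≤ h x) → sumℚ (map g xs) ≤ sumℚ (map h xs)
sumℚ-mono [] _ = ℚ.≤-refl
sumℚ-mono (x ∷ xs) g≤h = ℚ.+-mono-≤ (g≤h x) (sumℚ-mono xs g≤h)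

0≤sumℚ : ∀ {a} {A : Set a} {g : A → ℚ} xs → (∀ x → 0ℚ ≤ g x) → 0ℚ ≤ sumℚ (map g xs)
0≤sumℚ [] _ = ℚ.≤-refl
0≤sumℚ (x ∷ xs) 0≤g = 0≤+ (0≤g x) (0≤sumℚ xs 0≤g)

map-lookup-allFin : ∀ {a} {A : Set a} {n} (f : Vec A n) → map (lookup f) (allFin n) ≡ Data.Vec.toList f
map-lookup-allFin {n = n} f = trans (sym (Vec.toList-map (lookup f) (Data.Vec.allFin n))) (cong Data.Vec.toList (Vec.map-lookup-allFin f))

sumℚ-levels : ∀ {n} M (Y X : ℚ) (f : Val n) →
  sumℚ (map (λ v → if isAt M (lookup f v) then Y else X) (allFin n)) ≡ ι (countAt M f) * Y + ι (countOff M f) * X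
sumℚ-levels {n} M Y X f = begin
  sumℚ (map (level ∘ lookup f) (allFin n))     ≡⟨ cong sumℚ (List.map-∘ (allFin n)) ⟩
  sumℚ (map level (map (lookup f) (allFin n)))  ≡⟨ cong (sumℚ ∘ map level) (map-lookup-allFin f) ⟩
  sumℚ (map level (Data.Vec.toList f))          ≡⟨ over-toList f ⟩
  ι (countAt M f) * Y + ι (countOff M f) * X    ∎
  where
  open ≡-Reasoning
  open +-*-Solver
  level : Fin n → ℚ
  level a = if isAt M a then Y else X
  over-toList : ∀ {k} (f : Vec (Fin n) k) → sumℚ (map level (Data.Vec.toList f)) ≡ ι (countAt M f) * Y + ι (countOff M f) * X
  over-toList [] = solve 2 (λ Y X → con 0ℚ := con 0ℚ :* Y :+ con 0ℚ :* X) refl Y X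
  over-toList (a ∷ f) with isAt M a
  ... | true = trans (cong (λ s → Y + s) (over-toList f)) (trans
        (solve 4 (λ Y X c d → Y :+ (c :* Y :+ d :* X) := (con 1ℚ :+ c) :* Y :+ d :* X) refl Y X (ι (countAt M f)) (ι (countOff M f)))
        (cong (λ c → c * Y + ι (countOff M f) * X) (sym (ι-suc (countAt M f)))))
  ... | false = trans (cong (λ s → X + s) (over-toList f)) (trans
        (solve 4 (λ Y X c d → X :+ (c :* Y :+ d :* X) := c :* Y :+ (con 1ℚ :+ d) :* X) refl Y X (ι (countAt M f)) (ι (countOff M f)))
        (cong (λ d → ι (countAt M f) * Y + d * X) (sym (ι-suc (countOff M f)))))

private
  level-≤ : ∀ {n} (f : Val n) M {Y X : ℚ} {g : Fin n → ℚ} →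
    (∀ v → toℕ (lookup f v) ≡ M → g v ≤ Y) → (∀ v → toℕ (lookup f v) ≢ M → g v ≤ X) →
    ∀ v → g v ≤ (if isAt M (lookup f v) then Y else X)
  level-≤ f M at off v with toℕ (lookup f v) ℕ.≟ M
  ... | yes fv≡M = at v fv≡M
  ... | no fv≢M = off v fv≢M

  level-≥ : ∀ {n} (f : Val n) M {Y X : ℚ} {g : Fin n → ℚ} →
    (∀ v → toℕ (lookup f v) ≡ M → Y ≤ g v) → (∀ v → toℕ (lookup f v) ≢ M → X ≤ g v) →
    ∀ v → (if isAt M (lookup f v) then Y else X) ≤ g v
  level-≥ f M at off v with toℕ (lookup f v) ℕ.≟ M
  ... | yes fv≡M = at v fv≡M
  ... | no fv≢M = off v fv≢M

sumℚ-≤-levels : ∀ {n} (f : Val n) M {Y X : ℚ} (g : Fin n → ℚ) →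
  (∀ v → toℕ (lookup f v) ≡ M → g v ≤ Y) → (∀ v → toℕ (lookup f v) ≢ M → g v ≤ X) →
  sumℚ (map g (allFin n)) ≤ ι (countAt M f) * Y + ι (countOff M f) * X
sumℚ-≤-levels {n} f M {Y} {X} g at off =
  ℚ.≤-trans (sumℚ-mono (allFin n) (level-≤ f M at off)) (ℚ.≤-reflexive (sumℚ-levels M Y X f))

sumℚ-≥-levels : ∀ {n} (f : Val n) M {Y X : ℚ} (g : Fin n → ℚ) →
  (∀ v → toℕ (lookup f v) ≡ M → Y ≤ g v) → (∀ v → toℕ (lookup f v) ≢ M → X ≤ g v) →
  ι (countAt M f) * Y + ι (countOff M f) * X ≤ sumℚ (map g (allFin n))
sumℚ-≥-levels {n} f M {Y} {X} g at off =
  ℚ.≤-trans (ℚ.≤-reflexive (sym (sumℚ-levels M Y X f))) (sumℚ-mono (allFin n) (level-≥ f M at off))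

0≤truncTime : ∀ {n} (G : Adj n) t f → 0ℚ ≤ truncTime G t f
0≤truncTime G zero f = ℚ.≤-refl
0≤truncTime {n} G (suc t) f with absorbing G f
... | true = ℚ.≤-refl
... | false = 0≤+ {1ℚ} (ℚ.≤ᵇ⇒≤ _) (0≤* (0≤invℕ n) (0≤sumℚ (allFin n) (λ v → 0≤truncTime G t (step G f v))))

average-of-levels : ∀ c j n → c ℕ.+ suc j ≡ suc n → ∀ Y X →
  1ℚ + invℕ (suc n) * (ι c * Y + ι (suc j) * X) ≡ 1ℚ + Y - invℕ (suc n) * ι (suc j) * (Y - X)
average-of-levels c j n c+1+j≡1+n Y X = begin
  1ℚ + A * (ι c * Y + L * X)              ≡⟨ cong (λ z → 1ℚ + A * (z * Y + L * X)) ιc≡N-L ⟩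
  1ℚ + A * ((N - L) * Y + L * X)          ≡⟨ regroup A N L Y X ⟩
  1ℚ + (A * N) * Y - A * L * (Y - X)      ≡⟨ cong (λ u → 1ℚ + u * Y - A * L * (Y - X)) (invℕ-inverseˡ n) ⟩
  1ℚ + 1ℚ * Y - A * L * (Y - X)           ≡⟨ cong (λ y → 1ℚ + y - A * L * (Y - X)) (ℚ.*-identityˡ Y) ⟩
  1ℚ + Y - A * L * (Y - X)                ∎
  where
  open ≡-Reasoning
  open +-*-Solver
  A = invℕ (suc n)
  N = ι (suc n)
  L = ι (suc j)
  ιc≡N-L : ι c ≡ N - L
  ιc≡N-L = trans (solve 2 (λ c L → c := c :+ L :- L) refl (ι c) L)
                 (cong (_- L) (trans (sym (ι-+ c (suc j))) (cong ι c+1+j≡1+n)))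
  regroup : ∀ A N L Y X → 1ℚ + A * ((N - L) * Y + L * X) ≡ 1ℚ + (A * N) * Y - A * L * (Y - X)
  regroup = solve 5 (λ A N L Y X → con 1ℚ :+ A :* ((N :- L) :* Y :+ L :* X) := con 1ℚ :+ (A :* N) :* Y :- A :* L :* (Y :- X)) refl

harmonic-balance : ∀ c j n → c ℕ.+ suc j ≡ suc n →
  1ℚ + invℕ (suc n) * (ι c * (ι (suc n) * harmonic (suc j)) + ι (suc j) * (ι (suc n) * harmonic j)) ≡ ι (suc n) * harmonic (suc j)
harmonic-balance c j n c+1+j≡1+n = begin
  1ℚ + A * (ι c * Y + L * X)        ≡⟨ average-of-levels c j n c+1+j≡1+n Y X ⟩
  1ℚ + Y - A * L * (Y - X)          ≡⟨ cong (λ z → 1ℚ + Y - z) (solve 5 (λ A N L h b →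
                                         A :* L :* (N :* (h :+ b) :- N :* h) := (A :* N) :* (L :* b)) refl A N L (harmonic j) b) ⟩
  1ℚ + Y - (A * N) * (L * b)        ≡⟨ cong₂ (λ u w → 1ℚ + Y - u * w) (invℕ-inverseˡ n) (ι*invℕ≡1 j) ⟩
  1ℚ + Y - 1ℚ * 1ℚ                  ≡⟨ solve 1 (λ Y → con 1ℚ :+ Y :- con 1ℚ :* con 1ℚ := Y) refl Y ⟩
  Y                                 ∎
  where
  open ≡-Reasoning
  open +-*-Solver
  A = invℕ (suc n)
  N = ι (suc n)
  L = ι (suc j)
  b = invℕ (suc j)
  Y = N * harmonic (suc j)
  X = N * harmonic j

half-balance : ∀ c j n → c ℕ.+ suc j ≡ suc n → ∀ μ →
  1ℚ + invℕ (suc n) * (ι c * μ + ι (suc j) * (μ - ½ * (ι (suc n) * invℕ (suc j)))) ≡ μ + ½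
half-balance c j n c+1+j≡1+n μ = begin
  1ℚ + A * (ι c * μ + L * (μ - ½ * (N * b)))      ≡⟨ average-of-levels c j n c+1+j≡1+n μ _ ⟩
  1ℚ + μ - A * L * (μ - (μ - ½ * (N * b)))        ≡⟨ cong (λ z → 1ℚ + μ - z) (solve 5 (λ A N L μ b →
                                                       A :* L :* (μ :- (μ :- con ½ :* (N :* b))) := con ½ :* ((A :* N) :* (L :* b))) refl A N L μ b) ⟩
  1ℚ + μ - ½ * ((A * N) * (L * b))                ≡⟨ cong₂ (λ u w → 1ℚ + μ - ½ * (u * w)) (invℕ-inverseˡ n) (ι*invℕ≡1 j) ⟩
  1ℚ + μ - ½ * (1ℚ * 1ℚ)                          ≡⟨ solve 1 (λ μ → con 1ℚ :+ μ :- con ½ :* (con 1ℚ :* con 1ℚ) := μ :+ con ½) refl μ ⟩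
  μ + ½                                           ∎
  where
  open ≡-Reasoning
  open +-*-Solver
  A = invℕ (suc n)
  N = ι (suc n)
  L = ι (suc j)
  b = invℕ (suc j)

minPotential : ℕ → ℕ → ℕ → ℚ
minPotential n t j = (½ * (ι n * harmonic j)) ⊓ (½ * ι t)

minPotential-≤-level : ∀ n t j → minPotential n t j ≤ ½ * (ι n * harmonic j)
minPotential-≤-level n t j = ℚ.p⊓q≤p (½ * (ι n * harmonic j)) (½ * ι t)

minPotential-≤-clock : ∀ n t j → minPotential n t j ≤ ½ * ι t
minPotential-≤-clock n t j = ℚ.p⊓q≤q (½ * (ι n * harmonic j)) (½ * ι t)

minPotential-tick : ∀ n t j → minPotential n (suc t) j ≤ minPotential n t j + ½
minPotential-tick n t j = begin
  (½ * (ι n * harmonic j)) ⊓ (½ * ι (suc t))   ≡⟨ cong ((½ * (ι n * harmonic j)) ⊓_) (½*ι-suc t) ⟩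
  (½ * (ι n * harmonic j)) ⊓ (½ * ι t + ½)      ≤⟨ ⊓-+-≤ (½ * (ι n * harmonic j)) (½ * ι t) 0≤½ ⟩
  minPotential n t j + ½                        ∎
  where open ℚ.≤-Reasoning

minPotential-drop : ∀ n t j → minPotential n t (suc j) - ½ * (ι n * invℕ (suc j)) ≤ minPotential n t j
minPotential-drop n t j = ℚ.⊓-glb
  (ℚ.≤-trans (ℚ.+-monoˡ-≤ (- D) (minPotential-≤-level n t (suc j))) (ℚ.≤-reflexive level-drop))
  (ℚ.≤-trans (ℚ.+-monoʳ-≤ μ (ℚ.neg-antimono-≤ 0≤D))
    (ℚ.≤-trans (ℚ.≤-reflexive (ℚ.+-identityʳ μ)) (minPotential-≤-clock n t (suc j))))
  where
  open +-*-Solver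
  μ = minPotential n t (suc j)
  D = ½ * (ι n * invℕ (suc j))
  0≤D : 0ℚ ≤ D
  0≤D = 0≤* 0≤½ (0≤* (0≤ι n) (0≤invℕ (suc j)))
  level-drop : ½ * (ι n * harmonic (suc j)) - D ≡ ½ * (ι n * harmonic j)
  level-drop = solve 4 (λ h n x b → h :* (n :* (x :+ b)) :- h :* (n :* b) := h :* (n :* x)) refl ½ (ι n) (harmonic j) (invℕ (suc j))

minPotential-≤-0 : ∀ n t → minPotential n t 0 ≤ 0ℚ
minPotential-≤-0 n t = ℚ.≤-trans (minPotential-≤-level n t 0)
  (ℚ.≤-reflexive (trans (cong (½ *_) (ℚ.*-zeroʳ (ι n))) (ℚ.*-zeroʳ ½)))

-- The maximum model on the complete graph

module _ {k : ℕ} where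
  private
    N : ℕ
    N = suc (suc k)

  other-vertex : (v : Fin N) → ∃[ u ] u ≢ v
  other-vertex zero = suc zero , λ ()
  other-vertex (suc v) = zero , λ ()

  nbrMax-K : ∀ (f : Val N) v → ∃[ m ] nbrMax (K N) f v ≡ just m × IsMaxOn f (_≢ v) m
  nbrMax-K f v with foldr-combine-K f v (allFin N)
  ... | inj₁ (_ , all≡v) = ⊥-elim (proj₂ (other-vertex v) (all≡v _ (∈-allFin _)))
  ... | inj₂ (m , eq , (u , (_ , u≢v) , fu≡m) , bound) = m , eq , (u , u≢v , fu≡m) , λ w w≢v → bound w (∈-allFin w , w≢v)

  step-K : ∀ (f : Val N) v → ∃[ m ] step (K N) f v ≡ f [ v ]≔ m × IsMaxOn f (_≢ v) m
  step-K f v with nbrMax (K N) f v | nbrMax-K f v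
  ... | .(just m) | m , refl , m-max = m , refl , m-max

  maxOfOthers-≤ : ∀ (f : Val N) {v m} → IsMaxOn f (_≢ v) m → toℕ m ℕ.≤ maxValue f
  maxOfOthers-≤ f ((u , _ , fu≡m) , _) = subst (λ x → toℕ x ℕ.≤ maxValue f) fu≡m (lookup-≤-maxValue f u)

  maxOfOthers-≡ : ∀ (f : Val N) {v m} → IsMaxOn f (_≢ v) m → ∀ w → w ≢ v → toℕ (lookup f w) ≡ maxValue f → toℕ m ≡ maxValue f
  maxOfOthers-≡ f m-max@(_ , bound) w w≢v fw≡M = ℕ.≤-antisym (maxOfOthers-≤ f m-max) (subst (ℕ._≤ _) fw≡M (bound w w≢v))

  step-at-shared-max : ∀ (f : Val N) v w → w ≢ v → toℕ (lookup f v) ≡ maxValue f → toℕ (lookup f w) ≡ maxValue f → step (K N) f v ≡ f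
  step-at-shared-max f v w w≢v fv≡M fw≡M with step-K f v
  ... | m , step≡ , m-max = begin
    step (K N) f v      ≡⟨ step≡ ⟩
    f [ v ]≔ m          ≡⟨ cong (f [ v ]≔_) (Fin.toℕ-injective (trans (maxOfOthers-≡ f m-max w w≢v fw≡M) (sym fv≡M))) ⟩
    f [ v ]≔ lookup f v ≡⟨ Vec.[]≔-lookup f v ⟩
    f                   ∎
    where open ≡-Reasoning

  deficit-at-unique-max : ∀ (f : Val N) v → (∀ w → w ≢ v → toℕ (lookup f w) ≢ maxValue f) → suc k ℕ.≤ deficit f
  deficit-at-unique-max f v others≢M = ℕ.+-cancelˡ-≤ 1 _ _ (begin
    2 ℕ.+ k                                  ≡⟨ countAt+countOff (maxValue f) f ⟨
    countAt (maxValue f) f ℕ.+ deficit f     ≤⟨ ℕ.+-monoˡ-≤ (deficit f) (countAt≤1 (maxValue f) f v others≢M) ⟩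
    1 ℕ.+ deficit f                          ∎)
    where open ℕ.≤-Reasoning

  step-off-max : ∀ (f : Val N) v → toℕ (lookup f v) ≢ maxValue f →
    suc (deficit (step (K N) f v)) ≡ deficit f × maxValue (step (K N) f v) ≡ maxValue f
  step-off-max f v fv≢M with step-K f v | maxValue-attained f
  ... | m , step≡ , m-max | w , fw≡M rewrite step≡ = deficit-drops , max-kept
    where
    M = maxValue f
    w≢v : w ≢ v
    w≢v refl = fv≢M fw≡M
    m≡M : toℕ m ≡ M
    m≡M = maxOfOthers-≡ f m-max w w≢v fw≡M
    max-kept : maxValue (f [ v ]≔ m) ≡ M
    max-kept = maxValue-unique (f [ v ]≔ m) bounded (w , trans (cong toℕ (Vec.lookup∘update′ w≢v f m)) fw≡M)
      where
      bounded : ∀ i → toℕ (lookup (f [ v ]≔ m) i) ℕ.≤ M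
      bounded i with i ≟ v
      ... | yes refl = subst (ℕ._≤ M) (cong toℕ (sym (Vec.lookup∘update v f m))) (maxOfOthers-≤ f m-max)
      ... | no i≢v = subst (ℕ._≤ M) (cong toℕ (sym (Vec.lookup∘update′ i≢v f m))) (lookup-≤-maxValue f i)
    deficit-drops : suc (deficit (f [ v ]≔ m)) ≡ deficit f
    deficit-drops rewrite max-kept = countOff-update M f v m fv≢M m≡M

  -- A unique maximal vertex v may lower the maximum; this is excluded once deficit f ≤ k.
  data StepCase (f : Val N) (v : Fin N) : Set where
    at-max : toℕ (lookup f v) ≡ maxValue f → deficit (step (K N) f v) ℕ.≤ deficit f →
      (deficit f ℕ.≤ k → step (K N) f v ≡ f) → StepCase f v
    off-max : toℕ (lookup f v) ≢ maxValue f → suc (deficit (step (K N) f v)) ≡ deficit f →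
      maxValue (step (K N) f v) ≡ maxValue f → StepCase f v

  stepCase : ∀ (f : Val N) v → StepCase f v
  stepCase f v with toℕ (lookup f v) ℕ.≟ maxValue f
  ... | no fv≢M = off-max fv≢M (proj₁ (step-off-max f v fv≢M)) (proj₂ (step-off-max f v fv≢M))
  ... | yes fv≡M with Fin.any? (λ w → ¬? (w ≟ v) ×-dec (toℕ (lookup f w) ℕ.≟ maxValue f))
  ...   | yes (w , w≢v , fw≡M) = at-max fv≡M (ℕ.≤-reflexive (cong deficit unchanged)) (λ _ → unchanged)
    where
    unchanged : step (K N) f v ≡ f
    unchanged = step-at-shared-max f v w w≢v fv≡M fw≡M
  ...   | no no-other = at-max fv≡M (ℕ.≤-trans (deficit-≤ (step (K N) f v)) 1+k≤deficit)
            (λ deficit≤k → ⊥-elim (ℕ.<-irrefl refl (ℕ.≤-trans 1+k≤deficit deficit≤k)))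
    where
    1+k≤deficit : suc k ℕ.≤ deficit f
    1+k≤deficit = deficit-at-unique-max f v (λ w w≢v fw≡M → no-other (w , w≢v , fw≡M))

  deficit≡0⇒fixed : ∀ (f : Val N) → deficit f ≡ 0 → Fixed (K N) f
  deficit≡0⇒fixed f deficit≡0 v with stepCase f v
  ... | at-max _ _ unchanged = unchanged (subst (ℕ._≤ k) (sym deficit≡0) z≤n)
  ... | off-max _ drops _ = ⊥-elim (ℕ.1+n≢0 (trans drops deficit≡0))

  reachWithin-consensus : ∀ (f : Val N) {x : Fin N} → toℕ x ≡ maxValue f →
    ∀ s → deficit f ℕ.≤ s → reachWithin (K N) s f (replicate N x) ≡ true
  reachWithin-consensus f {x} x≡M s deficit≤s with deficit f ℕ.≟ 0
  ... | yes deficit≡0 = subst (λ g → reachWithin (K N) s g (replicate N x) ≡ true) (sym f≡consensus) (reachWithin-refl (K N) s (replicate N x))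
    where
    f≡consensus : f ≡ replicate N x
    f≡consensus = lookup-const⇒replicate f x (λ i → Fin.toℕ-injective (trans (countOff≡0 _ f deficit≡0 i) (sym x≡M)))
  ... | no deficit≢0 with countOff≢0 (maxValue f) f deficit≢0
  ...   | v , fv≢M with stepCase f v | s | deficit≤s
  ...     | at-max fv≡M _ _ | _ | _ = ⊥-elim (fv≢M fv≡M)
  ...     | off-max _ _ _ | zero | deficit≤0 = ⊥-elim (deficit≢0 (ℕ.n≤0⇒n≡0 deficit≤0))
  ...     | off-max _ drops kept | suc s | deficit≤1+s =
    trans (cong ((f ==V replicate N x) ∨_) (any-true (λ u → reachWithin (K N) s (step (K N) f u) (replicate N x)) (allFin N) (∈-allFin v) from-v))
          (Bool.∨-zeroʳ _)
    where
    from-v : reachWithin (K N) s (step (K N) f v) (replicate N x) ≡ true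
    from-v = reachWithin-consensus (step (K N) f v) (trans x≡M (sym kept)) s (ℕ.≤-pred (subst (ℕ._≤ suc s) (sym drops) deficit≤1+s))

  deficit≡0⇒absorbing : ∀ (f : Val N) → deficit f ≡ 0 → absorbing (K N) f ≡ true
  deficit≡0⇒absorbing f deficit≡0 = fixed⇒absorbing (K N) (deficit≡0⇒fixed f deficit≡0)

  absorbing⇒deficit≡0 : ∀ (f : Val N) → absorbing (K N) f ≡ true → deficit f ≡ 0
  absorbing⇒deficit≡0 f absorbs with deficit f ℕ.≟ 0
  ... | yes deficit≡0 = deficit≡0
  ... | no deficit≢0 = ⊥-elim (false≢true (trans (sym (reaches-fixed⇒not-absorbing (K N) consensus-fixed reached consensus≢f)) absorbs))
    where
    w = proj₁ (maxValue-attained f)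
    consensus = replicate N (lookup f w)
    consensus-fixed : Fixed (K N) consensus
    consensus-fixed = deficit≡0⇒fixed consensus (deficit-replicate {k = suc k} (lookup f w))
    reached : reach (K N) f consensus ≡ true
    reached = reachWithin-consensus f (proj₂ (maxValue-attained f)) (N ℕ.^ N)
      (ℕ.≤-trans (deficit-≤ f) (ℕ.≤-trans (ℕ.n≤1+n (suc k)) (n≤n^n N)))
    consensus≢f : consensus ≢ f
    consensus≢f consensus≡f = deficit≢0 (trans (cong deficit (sym consensus≡f)) (deficit-replicate {k = suc k} (lookup f w)))

  private
    expectedNext : ℕ → Val N → ℚ
    expectedNext t f = invℕ N * sumℚ (map (λ v → truncTime (K N) t (step (K N) f v)) (allFin N))

    countAt+1+j≡N : ∀ (f : Val N) {j} → deficit f ≡ suc j → countAt (maxValue f) f ℕ.+ suc j ≡ N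
    countAt+1+j≡N f deficit≡1+j = trans (cong (countAt (maxValue f) f ℕ.+_) (sym deficit≡1+j)) (countAt+countOff (maxValue f) f)

    0≤1+expectedNext : ∀ t f → 0ℚ ≤ 1ℚ + expectedNext t f
    0≤1+expectedNext t f = 0≤+ {1ℚ} (ℚ.≤ᵇ⇒≤ _) (0≤* (0≤invℕ N) (0≤sumℚ (allFin N) (λ v → 0≤truncTime (K N) t (step (K N) f v))))

  truncTime-≤-harmonic : ∀ t (f : Val N) → truncTime (K N) t f ≤ ι N * harmonic (deficit f)
  truncTime-≤-harmonic zero f = 0≤* (0≤ι N) (0≤harmonic (deficit f))
  truncTime-≤-harmonic (suc t) f with absorbing (K N) f in absorbs
  ... | true = 0≤* (0≤ι N) (0≤harmonic (deficit f))
  ... | false = bound (deficit f) refl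
    where
    M = maxValue f
    bound : ∀ d → deficit f ≡ d → 1ℚ + expectedNext t f ≤ ι N * harmonic (deficit f)
    bound zero deficit≡0 = ⊥-elim (false≢true (trans (sym absorbs) (deficit≡0⇒absorbing f deficit≡0)))
    bound (suc j) deficit≡1+j = begin
      1ℚ + expectedNext t f                                  ≤⟨ ℚ.+-monoʳ-≤ 1ℚ (*-monoˡ-≤-0≤ (0≤invℕ N) (sumℚ-≤-levels f M _ at off)) ⟩
      1ℚ + invℕ N * (ι (countAt M f) * Y + ι (deficit f) * X) ≡⟨ cong (λ d → 1ℚ + invℕ N * (ι (countAt M f) * Y + ι d * X)) deficit≡1+j ⟩
      1ℚ + invℕ N * (ι (countAt M f) * Y + ι (suc j) * X)     ≡⟨ harmonic-balance (countAt M f) j (suc k) (countAt+1+j≡N f deficit≡1+j) ⟩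
      Y                                                       ≡⟨ cong (λ d → ι N * harmonic d) deficit≡1+j ⟨
      ι N * harmonic (deficit f)                              ∎
      where
      open ℚ.≤-Reasoning
      Y = ι N * harmonic (suc j)
      X = ι N * harmonic j
      at : ∀ v → toℕ (lookup f v) ≡ M → truncTime (K N) t (step (K N) f v) ≤ Y
      at v fv≡M with stepCase f v
      ... | at-max _ no-increase _ = ℚ.≤-trans (truncTime-≤-harmonic t (step (K N) f v))
            (*-monoˡ-≤-0≤ (0≤ι N) (harmonic-mono-≤ (subst (deficit (step (K N) f v) ℕ.≤_) deficit≡1+j no-increase)))
      ... | off-max fv≢M _ _ = ⊥-elim (fv≢M fv≡M)
      off : ∀ v → toℕ (lookup f v) ≢ M → truncTime (K N) t (step (K N) f v) ≤ X
      off v fv≢M with stepCase f v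
      ... | at-max fv≡M _ _ = ⊥-elim (fv≢M fv≡M)
      ... | off-max _ drops _ = ℚ.≤-trans (truncTime-≤-harmonic t (step (K N) f v))
            (ℚ.≤-reflexive (cong (λ d → ι N * harmonic d) (ℕ.suc-injective (trans drops deficit≡1+j))))

  minPotential-≤-truncTime : ∀ t (f : Val N) → deficit f ℕ.≤ k → minPotential N t (deficit f) ≤ truncTime (K N) t f
  minPotential-≤-truncTime zero f _ = ℚ.≤-trans (minPotential-≤-clock N 0 (deficit f)) (ℚ.≤-reflexive (ℚ.*-zeroʳ ½))
  minPotential-≤-truncTime (suc t) f deficit≤k with absorbing (K N) f in absorbs
  ... | true = subst (λ d → minPotential N (suc t) d ≤ 0ℚ) (sym deficit≡0) (minPotential-≤-0 N (suc t))
    where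
    deficit≡0 : deficit f ≡ 0
    deficit≡0 = absorbing⇒deficit≡0 f absorbs
  ... | false = bound (deficit f) refl
    where
    M = maxValue f
    bound : ∀ d → deficit f ≡ d → minPotential N (suc t) (deficit f) ≤ 1ℚ + expectedNext t f
    bound zero deficit≡0 = ℚ.≤-trans (subst (λ d → minPotential N (suc t) d ≤ 0ℚ) (sym deficit≡0) (minPotential-≤-0 N (suc t)))
      (0≤1+expectedNext t f)
    bound (suc j) deficit≡1+j = begin
      minPotential N (suc t) (deficit f)                     ≡⟨ cong (minPotential N (suc t)) deficit≡1+j ⟩
      minPotential N (suc t) (suc j)                         ≤⟨ minPotential-tick N t (suc j) ⟩
      μ + ½                                                  ≡⟨ half-balance (countAt M f) j (suc k) (countAt+1+j≡N f deficit≡1+j) μ ⟨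
      1ℚ + invℕ N * (ι (countAt M f) * μ + ι (suc j) * (μ - D)) ≤⟨ ℚ.+-monoʳ-≤ 1ℚ (*-monoˡ-≤-0≤ (0≤invℕ N)
                                                                    (ℚ.+-monoʳ-≤ (ι (countAt M f) * μ) (*-monoˡ-≤-0≤ (0≤ι (suc j)) (minPotential-drop N t j)))) ⟩
      1ℚ + invℕ N * (ι (countAt M f) * μ + ι (suc j) * next)  ≡⟨ cong (λ d → 1ℚ + invℕ N * (ι (countAt M f) * μ + ι d * next)) deficit≡1+j ⟨
      1ℚ + invℕ N * (ι (countAt M f) * μ + ι (deficit f) * next) ≤⟨ ℚ.+-monoʳ-≤ 1ℚ (*-monoˡ-≤-0≤ (0≤invℕ N) (sumℚ-≥-levels f M _ at off)) ⟩
      1ℚ + expectedNext t f                                   ∎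
      where
      open ℚ.≤-Reasoning
      μ = minPotential N t (suc j)
      next = minPotential N t j
      D = ½ * (ι N * invℕ (suc j))
      at : ∀ v → toℕ (lookup f v) ≡ M → μ ≤ truncTime (K N) t (step (K N) f v)
      at v fv≡M with stepCase f v
      ... | at-max _ _ unchanged = subst (λ g → μ ≤ truncTime (K N) t g) (sym (unchanged deficit≤k))
            (subst (λ d → minPotential N t d ≤ truncTime (K N) t f) deficit≡1+j (minPotential-≤-truncTime t f deficit≤k))
      ... | off-max fv≢M _ _ = ⊥-elim (fv≢M fv≡M)
      off : ∀ v → toℕ (lookup f v) ≢ M → next ≤ truncTime (K N) t (step (K N) f v)
      off v fv≢M with stepCase f v
      ... | at-max fv≡M _ _ = ⊥-elim (fv≢M fv≡M)
      ... | off-max _ drops _ = subst (λ d → minPotential N t d ≤ truncTime (K N) t (step (K N) f v))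
            (ℕ.suc-injective (trans drops deficit≡1+j))
            (minPotential-≤-truncTime t (step (K N) f v) (ℕ.≤-trans (ℕ.n≤1+n _) (subst (ℕ._≤ k) (sym drops) deficit≤k)))

truncTime-≤-nlog : ∀ k t (f : Val (2 ℕ.+ k)) → truncTime (K (2 ℕ.+ k)) t f ≤ ι 2 * ι ((2 ℕ.+ k) ℕ.* ⌊log₂ (2 ℕ.+ k) ⌋)
truncTime-≤-nlog k t f = begin
  truncTime (K N) t f              ≤⟨ truncTime-≤-harmonic t f ⟩
  ι N * harmonic (deficit f)       ≤⟨ *-monoˡ-≤-0≤ (0≤ι N) (harmonic-mono-≤ (ℕ.≤-trans (deficit-≤ f) (ℕ.n≤1+n (suc k)))) ⟩
  ι N * harmonic N                 ≤⟨ *-monoˡ-≤-0≤ (0≤ι N) (harmonic-≤-log N (s≤s z≤n)) ⟩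
  ι N * (ι L + 1ℚ)                 ≤⟨ *-monoˡ-≤-0≤ (0≤ι N) (ℚ.+-monoʳ-≤ (ι L) (ι-mono-≤ (⌊log₂⌋-mono-≤ {2} {N} (s≤s (s≤s z≤n))))) ⟩
  ι N * (ι L + ι L)                ≡⟨ solve 2 (λ n l → n :* (l :+ l) := con (ι 2) :* (n :* l)) refl (ι N) (ι L) ⟩
  ι 2 * (ι N * ι L)                ≡⟨ cong (ι 2 *_) (ι-* N L) ⟨
  ι 2 * ι (N ℕ.* L)                ∎
  where
  open ℚ.≤-Reasoning
  open +-*-Solver
  N = 2 ℕ.+ k
  L = ⌊log₂ N ⌋

twoLeaders : ∀ k → Val (2 ℕ.+ k)
twoLeaders k = suc zero ∷ suc zero ∷ replicate k zero

deficit-twoLeaders : ∀ k → deficit (twoLeaders k) ≡ k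
deficit-twoLeaders k = trans (cong (λ M → countOff M (twoLeaders k)) (cong (λ m → 1 ℕ.⊔ (1 ℕ.⊔ m)) (max-zeros k))) (off-zeros k)
  where
  max-zeros : ∀ j → maxValue (replicate {A = Fin (2 ℕ.+ k)} j zero) ≡ 0
  max-zeros zero = refl
  max-zeros (suc j) = max-zeros j
  off-zeros : ∀ j → countOff 1 (replicate {A = Fin (2 ℕ.+ k)} j zero) ≡ j
  off-zeros zero = refl
  off-zeros (suc j) = cong suc (off-zeros j)

nlog-≤-truncTime : ∀ i → let N = 4 ℕ.+ i ; t = N ℕ.* ⌊log₂ N ⌋ in
  + 1 / 4 * ι t ≤ truncTime (K N) t (twoLeaders (2 ℕ.+ i))
nlog-≤-truncTime i = ℚ.≤-trans (ℚ.⊓-glb level-bound clock-bound)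
  (subst (λ d → minPotential N t d ≤ truncTime (K N) t (twoLeaders k)) (deficit-twoLeaders k)
    (minPotential-≤-truncTime t (twoLeaders k) (ℕ.≤-reflexive (deficit-twoLeaders k))))
  where
  open +-*-Solver
  k = 2 ℕ.+ i
  N = 2 ℕ.+ k
  L = ⌊log₂ N ⌋
  t = N ℕ.* L
  L≤1+log-k : L ℕ.≤ suc ⌊log₂ k ⌋
  L≤1+log-k = ℕ.≤-trans (ℕ.≤-reflexive (⌊log₂⌋-halve k)) (s≤s (⌊log₂⌋-mono-≤ (s≤s (s≤s (ℕ.⌊n/2⌋≤n i)))))
  level-bound : + 1 / 4 * ι t ≤ ½ * (ι N * harmonic k)
  level-bound = begin
    + 1 / 4 * ι t                        ≡⟨ cong (+ 1 / 4 *_) (ι-* N L) ⟩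
    + 1 / 4 * (ι N * ι L)                ≡⟨ solve 2 (λ n l → con (+ 1 / 4) :* (n :* l) := con ½ :* (n :* (con ½ :* l))) refl (ι N) (ι L) ⟩
    ½ * (ι N * (½ * ι L))                ≤⟨ *-monoˡ-≤-0≤ 0≤½ (*-monoˡ-≤-0≤ (0≤ι N) (*-monoˡ-≤-0≤ 0≤½ (ι-mono-≤ L≤1+log-k))) ⟩
    ½ * (ι N * (½ * ι (suc ⌊log₂ k ⌋)))  ≤⟨ *-monoˡ-≤-0≤ 0≤½ (*-monoˡ-≤-0≤ (0≤ι N) (log-≤-harmonic k (s≤s z≤n))) ⟩
    ½ * (ι N * harmonic k)               ∎
    where open ℚ.≤-Reasoning
  clock-bound : + 1 / 4 * ι t ≤ ½ * ι t
  clock-bound = *-monoʳ-≤-0≤ (0≤ι t) (ℚ.≤ᵇ⇒≤ {+ 1 / 4} {½} _)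

mainTheorem2 : Σ ℚ λ c → Σ ℚ λ C → (0ℚ < c) × (0ℚ < C) × Σ ℕ λ N → (n : ℕ) → n ≥ N →
    (((f : Val n) (t : ℕ) → truncTime (K n) t f ≤ C * ((+ (n Data.Nat.* ⌊log₂ n ⌋)) / 1))
    × (∃[ f ] ∃[ t ] (c * ((+ (n Data.Nat.* ⌊log₂ n ⌋)) / 1) ≤ truncTime (K n) t f)))
mainTheorem2 = + 1 / 4 , ι 2 , ℚ.positive⁻¹ (+ 1 / 4) , ℚ.positive⁻¹ (ι 2) , 4 ,
  λ { (suc (suc (suc (suc i)))) (s≤s (s≤s (s≤s (s≤s _)))) →
        (λ f t → truncTime-≤-nlog (2 ℕ.+ i) t f) ,
        twoLeaders (2 ℕ.+ i) , (4 ℕ.+ i) ℕ.* ⌊log₂ (4 ℕ.+ i) ⌋ , nlog-≤-truncTime i }
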